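{- Let $(L,\leq_L)$ and $(M,\leq_M)$ be finite posets, let $(\mathcal{L}^*,\preceq_*)$ be the dual-linearisation of $L$ and $(\mathcal{M},\preceq_{\mathcal{M}})$ the linearisation of $M$. If $f\colon L^n\to M$ is antitonic, then $\hat f\colon(\mathcal{L}^*)^n\to\mathcal{M}$ (defined in the context) is antitonic.
   Context: For a finite poset $(P,\leq)$, write $x<y$ for $x\leq y$, $x\neq y$. Levels: $P_0=\{x\in P : \nexists y\in P,\ x<y\}$, $P_i=\{x\in P\setminus(P_0\cup\cdots\cup P_{i-1}) : \nexists y\in P\setminus(P_0\cup\cdots\cup P_{i-1}),\ x<y\}$ for $i\geq1$; the linearisation is the set of nonempty levels with $[x]\preceq[y]$ iff $x\in P_i$, $y\in P_j$, $j\leq i$, where $[x]$ is the level of $x$. Dual-levels $P^*_i$ are defined identically with $x<y$ replaced by $y<x$; the dual-linearisation is the set of nonempty dual-levels with $[x]_*\preceq_*[y]_*$ iff $x\in P^*_i$, $y\in P^*_j$, $i\leq j$, where $[x]_*$ is the dual-level of $x$. Products are ordered componentwise; $f$ antitonic means $\vec x\leq\vec y$ implies $f(\vec x)\geq f(\vec y)$. Here $\hat f([x_1]_*,\dots,[x_n]_*)=\max\{[f(y_1,\dots,y_n)] : y_i\in[x_i]_* \text{ for all } i\}$, the max taken in $(\mathcal{M},\preceq_{\mathcal{M}})$. -}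

module Defs where

open import Level using (0ℓ)
open import Data.Nat using (ℕ; zero; suc; _≤_)
open import Data.Fin using (Fin)
open import Data.Empty using (⊥)
open import Data.Sum using (_⊎_)
open import Data.Product using (Σ; _×_; ∃-syntax)
open import Data.List using (List)
open import Data.List.Membership.Propositional using (_∈_)
open import Relation.Nullary using (¬_)
open import Relation.Binary using (IsPartialOrder; Decidable; DecidableEquality)
open import Relation.Binary.PropositionalEquality using (_≡_; _≢_)

record FinPoset : Set₁ where
  field
    Carrier        : Set
    _≤ₚ_           : Carrier → Carrier → Set
    isPartialOrder : IsPartialOrder _≡_ _≤ₚ_
    _≤?_           : Decidable _≤ₚ_
    _≟_            : DecidableEquality Carrier
    enum           : List Carrier
    complete       : ∀ x → x ∈ enum

  _<ₚ_ : Carrier → Carrier → Set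
  x <ₚ y = x ≤ₚ y × x ≢ y

open FinPoset public

module _ (P : FinPoset) where
  private
    _<_ = _<ₚ_ P
  mutual
    Removed : ℕ → Carrier P → Set
    Removed zero    x = ⊥
    Removed (suc i) x = Removed i x ⊎ Level i x

    Level : ℕ → Carrier P → Set
    Level i x = ¬ Removed i x × (∀ y → ¬ Removed i y → ¬ (x < y))

  mutual
    DualRemoved : ℕ → Carrier P → Set
    DualRemoved zero    x = ⊥
    DualRemoved (suc i) x = DualRemoved i x ⊎ DualLevel i x

    DualLevel : ℕ → Carrier P → Set
    DualLevel i x = ¬ DualRemoved i x × (∀ y → ¬ DualRemoved i y → ¬ (y < x))

Antitonic : (L M : FinPoset) (n : ℕ) → ((Fin n → Carrier L) → Carrier M) → Set
Antitonic L M n f =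
  ∀ (x y : Fin n → Carrier L) → (∀ k → _≤ₚ_ L (x k) (y k)) → _≤ₚ_ M (f y) (f x)

-- An n-tuple of (nonempty) dual-levels of L is given by indices i : Fin n → ℕ
-- (the k-th component being the dual-level L*_{i k}).  A nonempty level M_m of M
-- is given by its index m.  In the linearisation, M_a ⪯ M_b iff b ≤ a.
--
-- HatIs L M n f i m  :  f̂(L*_{i 1}, …, L*_{i n}) = M_m, i.e. M_m is the
-- ⪯_M-maximum of { [f(y)] : y_k ∈ L*_{i k} for all k }:
--   it is attained, and every [f(y)] = M_j satisfies M_j ⪯ M_m, i.e. m ≤ j.
HatIs : (L M : FinPoset) (n : ℕ) → ((Fin n → Carrier L) → Carrier M) →
        (Fin n → ℕ) → ℕ → Set
HatIs L M n f i m =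
  (∃[ y ] ((∀ k → DualLevel L (i k) (y k)) × Level M m (f y)))
  × (∀ (y : Fin n → Carrier L) → (∀ k → DualLevel L (i k) (y k)) →
       ∀ j → Level M j (f y) → m ≤ j)

-- All searches are finite: an exhaustively enumerated carrier has
-- decidable existentials, also over n-tuples, hence levels and dual-levels
-- are decidable.  Three order-theoretic facts about a finite poset P follow:
--   * every element lies in some level (an element escaping the first k
--     levels starts a strict chain of length k+1, impossible for k = |P|);
--   * levels reverse the order: a ≤ b, a ∈ P_p, b ∈ P_q imply q ≤ p;
--   * below every element of P*_{i′} lies an element of P*_i when i ≤ i′.
-- Existence of f̂ is then a least-number argument on level indices.  For
-- antitonicity, given i ≤ i′ and y′ realising f̂ at i′, push every component
-- of y′ down to dual-level i; the result y ≤ y′ gives f y′ ≤ f y, so the level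
-- of f y is at most that of f y′, and f̂ at i is at most the level of f y.

module Submission where

open import Defs
open import Data.Nat using (ℕ; _≤_)
open import Data.Fin using (Fin)
open import Data.Product using (Σ; _×_; ∃-syntax)

open import Data.Nat using (zero; suc; _<_; s≤s; z≤n; _≤′_; ≤′-refl; ≤′-step) renaming (_≤?_ to _≤ℕ?_)
open import Data.Nat.Properties using (≤-refl; ≤-trans; ≮⇒≥; ≰⇒>; n≤1+n; ≤⇒≤′; m<1+n⇒m<n∨m≡n)
import Data.Fin as F
open import Data.Fin.Properties using (pigeonhole; all?)
open import Data.Vec.Functional using (_∷_)
open import Data.Product using (_,_; proj₁; proj₂; ∃)
open import Data.Sum using (_⊎_; inj₁; inj₂)
open import Data.Empty using (⊥-elim)
open import Data.List using (List; length; lookup)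
open import Data.List.Membership.Propositional using (_∈_)
import Data.List.Relation.Unary.Any as Any
open import Data.List.Relation.Unary.Any.Properties using (lookup-index)
open import Relation.Nullary using (¬_; Dec; yes; no)
open import Relation.Nullary.Decidable using (map′; _×-dec_; _⊎-dec_; ¬?)
open import Relation.Binary using (IsPartialOrder)
open import Relation.Binary.PropositionalEquality using (_≡_; refl; sym; trans; subst; cong)

module _ {Q : ℕ → Set} (Q? : ∀ j → Dec (Q j)) where

  IsLeast : ℕ → Set
  IsLeast m = Q m × (∀ j → Q j → m ≤ j)

  least-below : ∀ b → ∃ IsLeast ⊎ (∀ j → j < b → ¬ Q j)
  least-below zero = inj₂ (λ _ ())
  least-below (suc b) with least-below b
  ... | inj₁ found = inj₁ found
  ... | inj₂ none with Q? b
  ...   | yes qb = inj₁ (b , qb , λ j qj → ≮⇒≥ (λ j<b → none j j<b qj))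
  ...   | no ¬qb = inj₂ λ j j<1+b → case (m<1+n⇒m<n∨m≡n j<1+b)
    where
    case : ∀ {j} → j < b ⊎ j ≡ b → ¬ Q j
    case (inj₁ j<b) = none _ j<b
    case (inj₂ refl) = ¬qb

  least : ∀ {j₀} → Q j₀ → ∃ IsLeast
  least {j₀} qj₀ with least-below (suc j₀)
  ... | inj₁ found = found
  ... | inj₂ none = ⊥-elim (none j₀ ≤-refl qj₀)

module ExhaustiveSearch {C : Set} (enum : List C) (complete : ∀ x → x ∈ enum) where

  ∃? : {Q : C → Set} → (∀ y → Dec (Q y)) → Dec (∃ Q)
  ∃? {Q} Q? with Any.any? Q? enum
  ... | yes found = yes (Any.satisfied found)
  ... | no ¬found = no λ (y , q) → ¬found (Any.map (λ { refl → q }) (complete y))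

  -- A predicate on tuples that only depends on the components; without
  -- function extensionality this has to be assumed explicitly.
  Extensional : ∀ {n} → ((Fin n → C) → Set) → Set
  Extensional Q = ∀ y y′ → (∀ k → y k ≡ y′ k) → Q y → Q y′

  ∃-tuple? : ∀ n (Q : (Fin n → C) → Set) → Extensional Q →
             (∀ y → Dec (Q y)) → Dec (∃ Q)
  ∃-tuple? zero Q ext Q? with Q? (λ ())
  ... | yes q = yes (_ , q)
  ... | no ¬q = no λ (y , q) → ¬q (ext y _ (λ ()) q)
  ∃-tuple? (suc n) Q ext Q? =
    map′ (λ (c , y , q) → c ∷ y , q)
         (λ (y , q) → y F.zero , (λ k → y (F.suc k)) , ext y _ split q)
         (∃? λ c → ∃-tuple? n (λ y → Q (c ∷ y)) (ext-tail c) (λ y → Q? (c ∷ y)))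
    where
    split : ∀ {y : Fin (suc n) → C} k → y k ≡ (y F.zero ∷ λ k → y (F.suc k)) k
    split F.zero = refl
    split (F.suc k) = refl
    ext-tail : ∀ c → Extensional (λ y → Q (c ∷ y))
    ext-tail c y y′ e = ext _ _ λ { F.zero → refl ; (F.suc k) → e k }

module LevelTheory (P : FinPoset) where
  open IsPartialOrder (isPartialOrder P) using (antisym) renaming (refl to ≤ₚ-refl; trans to ≤ₚ-trans)
  open ExhaustiveSearch (enum P) (complete P) public

  C : Set
  C = Carrier P

  _≤ₚ′_ _<ₚ′_ : C → C → Set
  _≤ₚ′_ = _≤ₚ_ P
  _<ₚ′_ = _<ₚ_ P

  <? : ∀ x y → Dec (x <ₚ′ y)
  <? x y = _≤?_ P x y ×-dec ¬? (_≟_ P x y)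

  <-trans : ∀ {x y z} → x <ₚ′ y → y <ₚ′ z → x <ₚ′ z
  <-trans (x≤y , x≢y) (y≤z , _) = ≤ₚ-trans x≤y y≤z , λ { refl → x≢y (antisym x≤y y≤z) }

  mutual
    Removed? : ∀ i x → Dec (Removed P i x)
    Removed? zero x = no λ ()
    Removed? (suc i) x = Removed? i x ⊎-dec Level? i x

    Level? : ∀ i x → Dec (Level P i x)
    Level? i x with Removed? i x
    ... | yes r = no λ l → proj₁ l r
    ... | no ¬r with ∃? (λ y → ¬? (Removed? i y) ×-dec <? x y)
    ...   | yes (y , ¬ry , x<y) = no λ l → proj₂ l y ¬ry x<y
    ...   | no ¬above = yes (¬r , λ y ¬ry x<y → ¬above (y , ¬ry , x<y))

  mutual
    DualRemoved? : ∀ i x → Dec (DualRemoved P i x)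
    DualRemoved? zero x = no λ ()
    DualRemoved? (suc i) x = DualRemoved? i x ⊎-dec DualLevel? i x

    DualLevel? : ∀ i x → Dec (DualLevel P i x)
    DualLevel? i x with DualRemoved? i x
    ... | yes r = no λ l → proj₁ l r
    ... | no ¬r with ∃? (λ y → ¬? (DualRemoved? i y) ×-dec <? y x)
    ...   | yes (y , ¬ry , y<x) = no λ l → proj₂ l y ¬ry y<x
    ...   | no ¬below = yes (¬r , λ y ¬ry y<x → ¬below (y , ¬ry , y<x))

  successor : ∀ {i x} → ¬ Removed P i x → ¬ Level P i x →
              ∃ λ y → ¬ Removed P i y × x <ₚ′ y
  successor {i} {x} ¬r ¬l with ∃? (λ y → ¬? (Removed? i y) ×-dec <? x y)
  ... | yes found = found
  ... | no ¬found = ⊥-elim (¬l (¬r , λ y ¬ry x<y → ¬found (y , ¬ry , x<y)))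

  predecessor : ∀ {i x} → ¬ DualRemoved P i x → ¬ DualLevel P i x →
                ∃ λ y → ¬ DualRemoved P i y × y <ₚ′ x
  predecessor {i} {x} ¬r ¬l with ∃? (λ y → ¬? (DualRemoved? i y) ×-dec <? y x)
  ... | yes found = found
  ... | no ¬found = ⊥-elim (¬l (¬r , λ y ¬ry y<x → ¬found (y , ¬ry , y<x)))

  Chain : ℕ → C → Set
  Chain k x = Σ (Fin (suc k) → C) λ c → c F.zero ≡ x × (∀ a b → a F.< b → c a <ₚ′ c b)

  prepend : ∀ {k x y} → x <ₚ′ y → Chain k y → Chain (suc k) x
  prepend {x = x} x<y (c , refl , increasing) = x ∷ c , refl , increasing′
    where
    increasing′ : ∀ a b → a F.< b → (x ∷ c) a <ₚ′ (x ∷ c) b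
    increasing′ F.zero (F.suc F.zero) _ = x<y
    increasing′ F.zero (F.suc (F.suc b)) _ = <-trans x<y (increasing F.zero (F.suc b) (s≤s z≤n))
    increasing′ (F.suc a) (F.suc b) (s≤s a<b) = increasing a b a<b

  climb : ∀ k x → Removed P k x ⊎ Chain k x
  climb zero x = inj₂ ((λ _ → x) , refl , λ { F.zero F.zero () })
  climb (suc k) x with Removed? (suc k) x
  ... | yes r = inj₁ r
  ... | no ¬r with successor (λ r → ¬r (inj₁ r)) (λ l → ¬r (inj₂ l))
  ...   | y , ¬ry , x<y with climb k y
  ...     | inj₁ ry = ⊥-elim (¬ry ry)
  ...     | inj₂ chain = inj₂ (prepend x<y chain)

  -- A chain is injective, so it cannot be longer than the enumeration.
  no-long-chain : ∀ x → ¬ Chain (length (enum P)) x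
  no-long-chain x (c , _ , increasing)
    with pigeonhole ≤-refl (λ a → Any.index (complete P (c a)))
  ... | a , b , a<b , same-index = proj₂ (increasing a b a<b)
        (trans (lookup-index (complete P (c a)))
          (trans (cong (lookup (enum P)) same-index) (sym (lookup-index (complete P (c b))))))

  level-of-removed : ∀ {i x} → Removed P i x → ∃ λ j → Level P j x
  level-of-removed {suc i} (inj₁ r) = level-of-removed r
  level-of-removed {suc i} (inj₂ l) = i , l

  has-level : ∀ x → ∃ λ j → Level P j x
  has-level x with climb (length (enum P)) x
  ... | inj₁ r = level-of-removed r
  ... | inj₂ chain = ⊥-elim (no-long-chain x chain)

  removed-mono : ∀ {p q x} → p ≤′ q → Removed P p x → Removed P q x
  removed-mono ≤′-refl r = r
  removed-mono (≤′-step p≤q) r = inj₁ (removed-mono p≤q r)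

  -- Levels reverse the order: a ≤ b with a ∈ P_p, b ∈ P_q forces q ≤ p.
  -- Otherwise b survives stage p, so a, being maximal there, equals b;
  -- but a is removed before stage q while b is not.
  level-antitone : ∀ {a b p q} → a ≤ₚ′ b → Level P p a → Level P q b → q ≤ p
  level-antitone {a} {b} {p} {q} a≤b lp lq with q ≤ℕ? p
  ... | yes q≤p = q≤p
  ... | no q≰p with _≟_ P a b
  ...   | yes refl = ⊥-elim (proj₁ lq (removed-mono (≤⇒≤′ (≰⇒> q≰p)) (inj₂ lp)))
  ...   | no a≢b = ⊥-elim (proj₂ lp b b-survives-p (a≤b , a≢b))
    where
    b-survives-p : ¬ Removed P p b
    b-survives-p r = proj₁ lq (removed-mono (≤⇒≤′ (≤-trans (n≤1+n p) (≰⇒> q≰p))) r)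

  step-down : ∀ {j y′} → DualLevel P (suc j) y′ → ∃ λ y → DualLevel P j y × y ≤ₚ′ y′
  step-down {j} (¬r , minimal) with predecessor (λ r → ¬r (inj₁ r)) (λ l → ¬r (inj₂ l))
  ... | y , ¬ry , y<y′ with DualRemoved? (suc j) y
  ...   | yes (inj₁ ry) = ⊥-elim (¬ry ry)
  ...   | yes (inj₂ ly) = y , ly , proj₁ y<y′
  ...   | no ¬ry′ = ⊥-elim (minimal y ¬ry′ y<y′)

  descend : ∀ {j j′ y′} → j ≤′ j′ → DualLevel P j′ y′ → ∃ λ y → DualLevel P j y × y ≤ₚ′ y′
  descend ≤′-refl l = _ , l , ≤ₚ-refl
  descend (≤′-step j≤j′) l with step-down l
  ... | z , lz , z≤y′ with descend j≤j′ lz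
  ...   | y , ly , y≤z = y , ly , ≤ₚ-trans y≤z z≤y′

module InducedMap (L M : FinPoset) (n : ℕ) (f : (Fin n → Carrier L) → Carrier M)
                  (anti : Antitonic L M n f) where
  private
    module L = LevelTheory L
    module M = LevelTheory M
    module Lₒ = IsPartialOrder (isPartialOrder L)
    module Mₒ = IsPartialOrder (isPartialOrder M)

  InDualLevels : (Fin n → ℕ) → (Fin n → Carrier L) → Set
  InDualLevels i y = ∀ k → DualLevel L (i k) (y k)

  -- An antitonic map respects componentwise equality (antisymmetry in M).
  f-resp : ∀ y y′ → (∀ k → y k ≡ y′ k) → f y ≡ f y′
  f-resp y y′ e = Mₒ.antisym (anti y′ y (λ k → Lₒ.reflexive (sym (e k))))
                             (anti y y′ (λ k → Lₒ.reflexive (e k)))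

  Attained : (Fin n → ℕ) → ℕ → Set
  Attained i j = ∃[ y ] (InDualLevels i y × Level M j (f y))

  Attained? : ∀ i j → Dec (Attained i j)
  Attained? i j = L.∃-tuple? n (λ y → InDualLevels i y × Level M j (f y)) transport
    (λ y → all? (λ k → L.DualLevel? (i k) (y k)) ×-dec M.Level? j (f y))
    where
    transport : L.Extensional (λ y → InDualLevels i y × Level M j (f y))
    transport y y′ e (dy , ly) = (λ k → subst (DualLevel L (i k)) (e k) (dy k)) ,
                                 subst (Level M j) (f-resp y y′ e) ly

  -- f̂ is defined on every tuple of nonempty dual-levels: the least attained
  -- level index is the ⪯_M-maximum.
  hat-exists : ∀ i x → InDualLevels i x → ∃[ m ] HatIs L M n f i m
  hat-exists i x dx with least (Attained? i) (x , dx , proj₂ (M.has-level (f x)))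
  ... | m , attained , below = m , attained , λ y dy j lj → below j (y , dy , lj)

  hat-antitone : ∀ {i i′} → (∀ k → i k ≤ i′ k) →
                 ∀ m m′ → HatIs L M n f i m → HatIs L M n f i′ m′ → m ≤ m′
  hat-antitone {i} i≤i′ m m′ (_ , m-least) ((y′ , dy′ , ly′) , _) =
    ≤-trans (m-least y dy j lj) (M.level-antitone (anti y y′ y≤y′) ly′ lj)
    where
    lowered : ∀ k → ∃ λ z → DualLevel L (i k) z × _≤ₚ_ L z (y′ k)
    lowered k = L.descend (≤⇒≤′ (i≤i′ k)) (dy′ k)
    y : Fin n → Carrier L
    y k = proj₁ (lowered k)
    dy : InDualLevels i y
    dy k = proj₁ (proj₂ (lowered k))
    y≤y′ : ∀ k → _≤ₚ_ L (y k) (y′ k)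
    y≤y′ k = proj₂ (proj₂ (lowered k))
    j : ℕ
    j = proj₁ (M.has-level (f y))
    lj : Level M j (f y)
    lj = proj₂ (M.has-level (f y))

proposition12 : (L M : FinPoset) (n : ℕ) (f : (Fin n → Carrier L) → Carrier M) →
    Antitonic L M n f →
    ∀ (i i′ : Fin n → ℕ) (x x′ : Fin n → Carrier L) →
    (∀ k → DualLevel L (i k) (x k)) →
    (∀ k → DualLevel L (i′ k) (x′ k)) →
    (∀ k → i k ≤ i′ k) →
    (∃[ m ] HatIs L M n f i m) × (∃[ m′ ] HatIs L M n f i′ m′) ×
    (∀ m m′ → HatIs L M n f i m → HatIs L M n f i′ m′ → m ≤ m′)
proposition12 L M n f anti i i′ x x′ dx dx′ i≤i′ =
  hat-exists i x dx , hat-exists i′ x′ dx′ , hat-antitone i≤i′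
  where open InducedMap L M n f anti
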